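{- A tree is complementary vanishing if and only if it is a star.
   Context: For a graph $G$ with vertex set $\{v_1,\dots,v_n\}$, $\mathcal{S}(G)$ is the set of real symmetric $n\times n$ matrices $A=[a_{i,j}]$ such that for $i\neq j$, $a_{i,j}\neq 0$ if and only if $v_iv_j\in E(G)$ (diagonal entries are unrestricted). A graph $G$ is complementary vanishing if there exist $A\in\mathcal{S}(G)$ and $B\in\mathcal{S}(\overline{G})$ with $AB=O$, where $\overline{G}$ is the complement of $G$. -}

module Defs where

open import Level using (Level; _⊔_) renaming (suc to lsuc)
open import Data.Nat using (ℕ; zero; suc; _<_)
open import Data.Fin using (Fin; zero; suc; inject₁; fromℕ)
open import Data.Product using (_×_; ∃; Σ)
open import Data.Sum using (_⊎_)
open import Data.Empty using (⊥)
open import Relation.Nullary using (¬_)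
open import Relation.Binary.PropositionalEquality using (_≡_; _≢_)
open import Relation.Binary.Structures using (IsTotalOrder)
open import Algebra.Bundles using (CommutativeRing)
open import Function.Bundles using (_⇔_)
open import Function.Definitions using (Injective)

-- The real numbers, axiomatised as a Dedekind-complete ordered field.
-- (agda-stdlib has no reals; every complete ordered field is isomorphic
-- to ℝ, so quantifying over all such structures is faithful.)

record RealField (c ℓ₁ ℓ₂ : Level) : Set (lsuc (c ⊔ ℓ₁ ⊔ ℓ₂)) where
  field
    commutativeRing : CommutativeRing c ℓ₁
  open CommutativeRing commutativeRing public
  field
    _≤_          : Carrier → Carrier → Set ℓ₂
    isTotalOrder : IsTotalOrder _≈_ _≤_
    0≉1          : ¬ (0# ≈ 1#)
    inverse      : ∀ x → ¬ (x ≈ 0#) → ∃ λ y → x * y ≈ 1#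
    +-monoˡ-≤    : ∀ {x y} z → x ≤ y → (x + z) ≤ (y + z)
    *-nonneg     : ∀ {x y} → 0# ≤ x → 0# ≤ y → 0# ≤ (x * y)
    sup          : (P : Carrier → Set (c ⊔ ℓ₁ ⊔ ℓ₂)) →
                   (∃ λ x → P x) →
                   (∃ λ b → ∀ x → P x → x ≤ b) →
                   ∃ λ s → (∀ x → P x → x ≤ s) ×
                           (∀ b → (∀ x → P x → x ≤ b) → s ≤ b)

record Graph (n : ℕ) : Set₁ where
  field
    Adj     : Fin n → Fin n → Set
    sym     : ∀ {i j} → Adj i j → Adj j i
    irrefl  : ∀ {i} → ¬ Adj i i

open Graph public

complement : ∀ {n} → Graph n → Graph n
complement G = record
  { Adj    = λ i j → (i ≢ j) × ¬ Adj G i j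
  ; sym    = λ { (i≢j , ¬a) → (λ e → i≢j (symm e)) , (λ a → ¬a (Graph.sym G a)) }
  ; irrefl = λ { (i≢i , _) → i≢i _≡_.refl }
  }
  where
  open import Data.Product using (_,_)
  symm : ∀ {A : Set} {x y : A} → x ≡ y → y ≡ x
  symm _≡_.refl = _≡_.refl

data Walk {n : ℕ} (G : Graph n) : Fin n → Fin n → Set where
  here : ∀ {u} → Walk G u u
  step : ∀ {u w v} → Adj G u w → Walk G w v → Walk G u v

Connected : ∀ {n} → Graph n → Set
Connected G = ∀ u v → Walk G u v

HasCycle : ∀ {n} → Graph n → Set
HasCycle {n} G = Σ ℕ λ k → Σ (Fin (suc (suc (suc k))) → Fin n) λ f →
  Injective _≡_ _≡_ f ×
  (∀ (i : Fin (suc (suc k))) → Adj G (f (inject₁ i)) (f (suc i))) ×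
  Adj G (f (fromℕ (suc (suc k)))) (f zero)

Acyclic : ∀ {n} → Graph n → Set
Acyclic G = ¬ HasCycle G

IsTree : ∀ {n} → Graph n → Set
IsTree {n} G = (0 < n) × Connected G × Acyclic G

IsStar : ∀ {n} → Graph n → Set
IsStar {n} G = Σ (Fin n) λ c → ∀ i j → Adj G i j ⇔ ((i ≢ j) × (i ≡ c ⊎ j ≡ c))

module _ {c ℓ₁ ℓ₂} (R : RealField c ℓ₁ ℓ₂) where
  open RealField R using (Carrier; _≈_; _+_; _*_; 0#)

  Matrix : ℕ → Set c
  Matrix n = Fin n → Fin n → Carrier

  ∑ : ∀ {n} → (Fin n → Carrier) → Carrier
  ∑ {zero}  f = 0#
  ∑ {suc n} f = f zero + ∑ (λ i → f (suc i))

  _⊗_ : ∀ {n} → Matrix n → Matrix n → Matrix n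
  (A ⊗ B) i j = ∑ (λ k → A i k * B k j)

  InS : ∀ {n} → Graph n → Matrix n → Set ℓ₁
  InS G A = (∀ i j → A i j ≈ A j i) ×
            (∀ i j → i ≢ j → (¬ (A i j ≈ 0#)) ⇔ Adj G i j)

  ComplementaryVanishing : ∀ {n} → Graph n → Set (c ⊔ ℓ₁)
  ComplementaryVanishing {n} G =
    Σ (Matrix n) λ A → Σ (Matrix n) λ B →
      InS G A × InS (complement G) B × (∀ i j → (A ⊗ B) i j ≈ 0#)

{-# OPTIONS --safe #-}
-- Let ℓ be a leaf of the tree with neighbour p, and AB = O with A ∈ S(G), B ∈ S(Ḡ).
-- Row ℓ of A is supported on {ℓ, p}, so A ℓℓ B ℓj + A ℓp B pj = 0 for every j.
-- If p were not adjacent to some j ∉ {ℓ, p}, then B pj ≠ 0 forces A ℓℓ ≠ 0; but every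
-- x ∉ {ℓ, p} is non-adjacent to ℓ, so B ℓx ≠ 0, hence B px ≠ 0 and x is not adjacent
-- to p either: {ℓ, p} would be a component.  So p is adjacent to every vertex, and as
-- a tree has no triangles, G is the star centred at p.  A leaf exists at the end of a
-- maximal path.  Conversely, for the star with centre c take A its adjacency matrix and
-- B vanishing on the row and column of c and equal to J − (n − 1) I on the leaves:
-- every leaf column of B sums to zero, which is what the only nonzero row of A sees.
module Submission where

open import Defs
open import Level using (Level)
open import Data.Nat as ℕ using (ℕ; zero; suc; z≤n; s≤s)
import Data.Nat.Properties as ℕₚ
open import Data.Fin using (Fin; zero; suc; inject₁; fromℕ; toℕ; punchIn; punchOut; _≟_)
open import Data.Fin.Properties using (any?; toℕ-fromℕ; inject₁-injective; toℕ-inject₁; injective⇒≤;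
  punchInᵢ≢i; punchIn-injective; punchIn-punchOut)
open import Data.Fin.Relation.Unary.Top using (View; view; ‵fromℕ; ‵inj₁)
open import Data.Vec.Functional using ([]; _∷_; removeAt)
open import Data.Product using (Σ; _×_; _,_; proj₂)
open import Data.Sum using (_⊎_; inj₁; inj₂; [_,_])
open import Data.Empty using (⊥-elim)
open import Data.Unit using (⊤; tt)
open import Function.Base using (_∘_)
open import Function.Bundles using (_⇔_; mk⇔; Equivalence)
open import Function.Definitions using (Injective)
open import Relation.Nullary using (¬_; Dec; yes; no; ¬?)
open import Relation.Nullary.Decidable using (_×-dec_; dec-yes; dec-no)
open import Relation.Nullary.Negation using (¬¬-map)
open import Relation.Binary.PropositionalEquality using (_≡_; _≢_; refl; cong; subst; subst₂; ≢-sym)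
import Relation.Binary.PropositionalEquality as ≡

∷-injective : ∀ {a} {A : Set a} {m} {x : A} {f : Fin m → A} →
              (∀ i → f i ≢ x) → Injective _≡_ _≡_ f → Injective _≡_ _≡_ (x ∷ f)
∷-injective x∉f f-inj {zero}  {zero}  _ = refl
∷-injective x∉f f-inj {zero}  {suc j} x≡fj = ⊥-elim (x∉f j (≡.sym x≡fj))
∷-injective x∉f f-inj {suc i} {zero}  fi≡x = ⊥-elim (x∉f i fi≡x)
∷-injective x∉f f-inj {suc i} {suc j} fi≡fj = cong suc (f-inj fi≡fj)

module _ {n : ℕ} (G : Graph n) where

  Chain : ∀ {m} → (Fin (suc m) → Fin n) → Set
  Chain f = ∀ j → Adj G (f (inject₁ j)) (f (suc j))

  closed-chain⇒cycle : ∀ {m} (f : Fin (suc m) → Fin n) → Injective _≡_ _≡_ f → Chain f →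
                       ∀ {i} → View i → 2 ℕ.≤ toℕ i → Adj G (f i) (f zero) → HasCycle G
  closed-chain⇒cycle {suc (suc k)} f f-inj f-chain ‵fromℕ _ fᵢ~f₀ = k , f , f-inj , f-chain , fᵢ~f₀
  closed-chain⇒cycle {suc m} f f-inj f-chain (‵inj₁ {i = j} v) 2≤j fⱼ~f₀ =
    closed-chain⇒cycle (f ∘ inject₁) (inject₁-injective ∘ f-inj) (f-chain ∘ inject₁) v
                       (subst (2 ℕ.≤_) (toℕ-inject₁ j) 2≤j) fⱼ~f₀
  closed-chain⇒cycle {suc zero} f f-inj f-chain ‵fromℕ (s≤s ()) _

  triangle⇒cycle : ∀ {x y z} → x ≢ y → y ≢ z → x ≢ z →
                   Adj G x y → Adj G y z → Adj G z x → HasCycle G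
  triangle⇒cycle {x} {y} {z} x≢y y≢z x≢z x~y y~z z~x = 0 , (x ∷ y ∷ z ∷ []) , injective , chain , z~x
    where
    injective : Injective _≡_ _≡_ (x ∷ y ∷ z ∷ [])
    injective = ∷-injective (λ { zero → ≢-sym x≢y ; (suc zero) → ≢-sym x≢z ; (suc (suc ())) })
                  (∷-injective (λ { zero → ≢-sym y≢z ; (suc ()) }) (∷-injective (λ ()) λ { {()} }))
    chain : Chain (x ∷ y ∷ z ∷ [])
    chain zero = x~y
    chain (suc zero) = y~z

  length : ∀ {u v} → Walk G u v → ℕ
  length here       = 0
  length (step _ w) = suc (length w)

  vertex : ∀ {u v} (w : Walk G u v) → Fin (suc (length w)) → Fin n
  vertex {u} here       = λ _ → u
  vertex {u} (step _ w) = u ∷ vertex w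

  vertex-zero : ∀ {u v} (w : Walk G u v) → vertex w zero ≡ u
  vertex-zero here       = refl
  vertex-zero (step _ _) = refl

  vertex-last : ∀ {u v} (w : Walk G u v) → vertex w (fromℕ (length w)) ≡ v
  vertex-last here       = refl
  vertex-last (step _ w) = vertex-last w

  vertex-chain : ∀ {u v} (w : Walk G u v) → Chain (vertex w)
  vertex-chain (step u~w w) zero    = subst (Adj G _) (≡.sym (vertex-zero w)) u~w
  vertex-chain (step _ w)   (suc j) = vertex-chain w j

  NonRepeating : ∀ {u v} → Walk G u v → Set
  NonRepeating here           = ⊤
  NonRepeating {u} (step _ w) = (∀ i → vertex w i ≢ u) × NonRepeating w

  nonRepeating⇒injective : ∀ {u v} (w : Walk G u v) → NonRepeating w → Injective _≡_ _≡_ (vertex w)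
  nonRepeating⇒injective here       _              {zero} {zero} _ = refl
  nonRepeating⇒injective (step _ w) (u∉w , w-nr) = ∷-injective u∉w (nonRepeating⇒injective w w-nr)

  Path : Fin n → Fin n → Set
  Path u v = Σ (Walk G u v) NonRepeating

  suffix : ∀ {u v} (w : Walk G u v) → NonRepeating w → (i : Fin (suc (length w))) → Path (vertex w i) v
  suffix here         _          zero    = here , tt
  suffix (step u~w w) w-nr       zero    = step u~w w , w-nr
  suffix (step _ w)   (_ , w-nr) (suc i) = suffix w w-nr i

  shortcut : ∀ {u v} → Walk G u v → Path u v
  shortcut here = here , tt
  shortcut {u} {v} (step u~w w) with shortcut w
  ... | p , p-nr with any? (λ i → vertex p i ≟ u)
  ...   | yes (i , pᵢ≡u) = subst (λ x → Path x v) pᵢ≡u (suffix p p-nr i)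
  ...   | no u∉p         = step u~w p , (λ i pᵢ≡u → u∉p (i , pᵢ≡u)) , p-nr

  nonRepeating-closed⇒cycle : ∀ {u v} (p : Walk G u v) → NonRepeating p → 2 ℕ.≤ length p →
                              Adj G v u → HasCycle G
  nonRepeating-closed⇒cycle p p-nr 2≤p v~u =
    closed-chain⇒cycle (vertex p) (nonRepeating⇒injective p p-nr) (vertex-chain p) (view (fromℕ (length p)))
      (subst (2 ℕ.≤_) (≡.sym (toℕ-fromℕ (length p))) 2≤p)
      (subst₂ (Adj G) (≡.sym (vertex-last p)) (≡.sym (vertex-zero p)) v~u)

  walk-preserves : (P : Fin n → Set) → (∀ {u v} → Adj G u v → P u → P v) →
                   ∀ {u v} → Walk G u v → P u → P v
  walk-preserves P P-closed here         Pu = Pu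
  walk-preserves P P-closed (step u~w w) Pu = walk-preserves P P-closed w (P-closed u~w Pu)

  Dominating : Fin n → Set
  Dominating p = ∀ j → j ≢ p → Adj G p j

  dominating⇒star : Acyclic G → ∀ {p} → Dominating p → IsStar G
  dominating⇒star acyclic {p} p-dom = p , λ i j → mk⇔ (edge⇒star-edge i j) (star-edge⇒edge i j)
    where
    edge⇒star-edge : ∀ i j → Adj G i j → (i ≢ j) × (i ≡ p ⊎ j ≡ p)
    edge⇒star-edge i j i~j = i≢j , incident
      where
      i≢j : i ≢ j
      i≢j refl = irrefl G i~j
      incident : i ≡ p ⊎ j ≡ p
      incident with i ≟ p | j ≟ p
      ... | yes i≡p | _       = inj₁ i≡p
      ... | no _    | yes j≡p = inj₂ j≡p
      ... | no i≢p  | no j≢p  = ⊥-elim (acyclic (triangle⇒cycle (≢-sym i≢p) i≢j (≢-sym j≢p)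
                                                  (p-dom i i≢p) i~j (sym G (p-dom j j≢p))))
    star-edge⇒edge : ∀ i j → (i ≢ j) × (i ≡ p ⊎ j ≡ p) → Adj G i j
    star-edge⇒edge i j (i≢j , inj₁ refl) = p-dom j (≢-sym i≢j)
    star-edge⇒edge i j (i≢j , inj₂ refl) = sym G (p-dom i i≢j)

  record Leaf : Set where
    field
      leaf support   : Fin n
      leaf~support   : Adj G leaf support
      support-unique : ∀ {x} → Adj G leaf x → x ≡ support

  module _ (connected : Connected G) (acyclic : Acyclic G) where

    adjacent? : ∀ u v → Dec (Adj G u v)
    adjacent? u v with shortcut (connected u v)
    ... | here , _                     = no (irrefl G)
    ... | step u~v here , _            = yes u~v
    ... | p@(step _ (step _ _)) , p-nr =
      no λ u~v → acyclic (nonRepeating-closed⇒cycle p p-nr (s≤s (s≤s z≤n)) (sym G u~v))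

    extend-or-leaf : ∀ {m} (f : Fin (suc (suc m)) → Fin n) → Injective _≡_ _≡_ f → Chain f →
                     Leaf ⊎ Σ (Fin (suc (suc (suc m))) → Fin n) λ g → Injective _≡_ _≡_ g × Chain g
    extend-or-leaf f f-inj f-chain with any? (λ x → adjacent? (f zero) x ×-dec ¬? (any? λ i → f i ≟ x))
    ... | yes (x , f₀~x , x∉f) =
      inj₂ (x ∷ f , ∷-injective (λ i fᵢ≡x → x∉f (i , fᵢ≡x)) f-inj ,
            λ { zero → sym G f₀~x ; (suc j) → f-chain j })
    ... | no cannot-extend = inj₁ (record
      { leaf = f zero ; support = f (suc zero) ; leaf~support = f-chain zero ; support-unique = unique })
      where
      unique : ∀ {x} → Adj G (f zero) x → x ≡ f (suc zero)
      unique {x} f₀~x with any? (λ i → f i ≟ x)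
      ... | no x∉f                   = ⊥-elim (cannot-extend (x , f₀~x , x∉f))
      ... | yes (zero , refl)        = ⊥-elim (irrefl G f₀~x)
      ... | yes (suc zero , refl)    = refl
      ... | yes (suc (suc i) , refl) =
        ⊥-elim (acyclic (closed-chain⇒cycle f f-inj f-chain (view (suc (suc i))) (s≤s (s≤s z≤n)) (sym G f₀~x)))

    leaf-from-chain : ∀ fuel {m} (f : Fin (suc (suc m)) → Fin n) → Injective _≡_ _≡_ f → Chain f →
                      n ℕ.≤ fuel ℕ.+ suc (suc m) → Leaf
    leaf-from-chain fuel f f-inj f-chain n≤ with extend-or-leaf f f-inj f-chain
    ... | inj₁ L = L
    ... | inj₂ (g , g-inj , g-chain) with fuel
    ...   | zero       = ⊥-elim (ℕₚ.<-irrefl refl (ℕₚ.≤-trans (injective⇒≤ g-inj) n≤))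
    ...   | suc fuel′  = leaf-from-chain fuel′ g g-inj g-chain (subst (n ℕ.≤_) (≡.sym (ℕₚ.+-suc fuel′ _)) n≤)

    leaf-exists : ∀ {u v} → u ≢ v → Leaf
    leaf-exists {u} {v} u≢v with connected u v
    ... | here               = ⊥-elim (u≢v refl)
    ... | step {w = w} u~w _ = leaf-from-chain n (u ∷ w ∷ []) injective (λ { zero → u~w }) (ℕₚ.m≤m+n n 2)
      where
      injective : Injective _≡_ _≡_ (u ∷ w ∷ [])
      injective = ∷-injective (λ { zero refl → irrefl G u~w ; (suc ()) }) (∷-injective (λ ()) λ { {()} })

¬¬-pull : ∀ {a} {m} {P : Fin m → Set a} → (∀ k → ¬ ¬ P k) → ¬ ¬ (∀ k → P k)
¬¬-pull {m = zero}  ¬¬P ¬∀P = ¬∀P λ ()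
¬¬-pull {m = suc m} ¬¬P ¬∀P =
  ¬¬P zero λ P₀ → ¬¬-pull (¬¬P ∘ suc) λ P₊ → ¬∀P λ { zero → P₀ ; (suc k) → P₊ k }

module _ {r ℓ₁ ℓ₂} (R : RealField r ℓ₁ ℓ₂) where
  open RealField R using (Carrier; _≈_; _+_; _*_; -_; _-_; 0#; 1#; 0≉1; inverse; setoid; semiring;
    +-congˡ; +-comm; *-congˡ; *-congʳ; *-comm; *-assoc; +-identityˡ; +-identityʳ; *-identityˡ;
    zeroˡ; zeroʳ; -‿inverseʳ)
    renaming (refl to ≈-refl; sym to ≈-sym; trans to ≈-trans; reflexive to ≈-reflexive)
  open import Algebra.Properties.Semiring.Sum semiring
    using (sum; sum-cong-≋; sum-replicate-zero; sum-remove; ∑-distrib-+)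
  open import Relation.Binary.Reasoning.Setoid setoid

  ∑≡sum : ∀ {m} (f : Fin m → Carrier) → ∑ R f ≡ sum f
  ∑≡sum {zero}  f = refl
  ∑≡sum {suc m} f = cong (f zero +_) (∑≡sum (f ∘ suc))

  sum-zero : ∀ {m} {f : Fin m → Carrier} → (∀ k → f k ≈ 0#) → sum f ≈ 0#
  sum-zero {m} f≈0 = ≈-trans (sum-cong-≋ f≈0) (sum-replicate-zero m)

  sum-supported-at : ∀ {m} (f : Fin m → Carrier) i → (∀ k → k ≢ i → f k ≈ 0#) → sum f ≈ f i
  sum-supported-at {suc m} f i f≈0 = begin
    sum f                    ≈⟨ sum-remove f ⟩
    f i + sum (removeAt f i) ≈⟨ +-congˡ (sum-zero λ k → f≈0 (punchIn i k) (punchInᵢ≢i i k)) ⟩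
    f i + 0#                 ≈⟨ +-identityʳ (f i) ⟩
    f i                      ∎

  sum-supported-at-pair : ∀ {m} (f : Fin m → Carrier) {i j} → i ≢ j →
                          (∀ k → k ≢ i → k ≢ j → f k ≈ 0#) → sum f ≈ f i + f j
  sum-supported-at-pair {suc m} f {i} {j} i≢j f≈0 = begin
    sum f                              ≈⟨ sum-remove f ⟩
    f i + sum (removeAt f i)           ≈⟨ +-congˡ (sum-supported-at (removeAt f i) (punchOut i≢j) off-j) ⟩
    f i + f (punchIn i (punchOut i≢j)) ≡⟨ cong (λ k → f i + f k) (punchIn-punchOut i≢j) ⟩
    f i + f j                          ∎
    where
    off-j : ∀ k → k ≢ punchOut i≢j → f (punchIn i k) ≈ 0#
    off-j k k≢j′ = f≈0 (punchIn i k) (punchInᵢ≢i i k) λ iₖ≡j →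
      k≢j′ (punchIn-injective i k _ (≡.trans iₖ≡j (≡.sym (punchIn-punchOut i≢j))))

  1≉0 : ¬ 1# ≈ 0#
  1≉0 = 0≉1 ∘ ≈-sym

  x*y≈0⇒y≈0 : ∀ {x y} → ¬ x ≈ 0# → x * y ≈ 0# → y ≈ 0#
  x*y≈0⇒y≈0 {x} {y} x≉0 xy≈0 with inverse x x≉0
  ... | x⁻¹ , xx⁻¹≈1 = begin
    y              ≈⟨ *-identityˡ y ⟨
    1# * y         ≈⟨ *-congʳ xx⁻¹≈1 ⟨
    x * x⁻¹ * y    ≈⟨ *-congʳ (*-comm x x⁻¹) ⟩
    x⁻¹ * x * y    ≈⟨ *-assoc x⁻¹ x y ⟩
    x⁻¹ * (x * y)  ≈⟨ *-congˡ xy≈0 ⟩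
    x⁻¹ * 0#       ≈⟨ zeroʳ x⁻¹ ⟩
    0#             ∎

  x≉0∧y≉0⇒x*y≉0 : ∀ {x y} → ¬ x ≈ 0# → ¬ y ≈ 0# → ¬ x * y ≈ 0#
  x≉0∧y≉0⇒x*y≉0 x≉0 y≉0 = y≉0 ∘ x*y≈0⇒y≈0 x≉0

  x*y≉0⇒x≉0 : ∀ {x y} → ¬ x * y ≈ 0# → ¬ x ≈ 0#
  x*y≉0⇒x≉0 {x} {y} xy≉0 x≈0 = xy≉0 (≈-trans (*-congʳ x≈0) (zeroˡ y))

  x*y≉0⇒y≉0 : ∀ {x y} → ¬ x * y ≈ 0# → ¬ y ≈ 0#
  x*y≉0⇒y≉0 {x} {y} xy≉0 y≈0 = xy≉0 (≈-trans (*-congˡ y≈0) (zeroʳ x))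

  x+y≈0∧x≉0⇒y≉0 : ∀ {x y} → x + y ≈ 0# → ¬ x ≈ 0# → ¬ y ≈ 0#
  x+y≈0∧x≉0⇒y≉0 {x} {y} x+y≈0 x≉0 y≈0 = x≉0 (begin
    x      ≈⟨ +-identityʳ x ⟨
    x + 0# ≈⟨ +-congˡ y≈0 ⟨
    x + y  ≈⟨ x+y≈0 ⟩
    0#     ∎)

  module _ {n} {G : Graph n} {A B : Matrix R n} (A∈S : InS R G A) (B∈S : InS R (complement G) B)
           (AB≈0 : ∀ i j → (_⊗_ R A B) i j ≈ 0#) where

    adjacent⇒A≉0 : ∀ {i j} → i ≢ j → Adj G i j → ¬ A i j ≈ 0#
    adjacent⇒A≉0 i≢j = Equivalence.from (proj₂ A∈S _ _ i≢j)

    A≉0⇒adjacent : ∀ {i j} → i ≢ j → ¬ A i j ≈ 0# → Adj G i j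
    A≉0⇒adjacent i≢j = Equivalence.to (proj₂ A∈S _ _ i≢j)

    nonadjacent⇒B≉0 : ∀ {i j} → i ≢ j → ¬ Adj G i j → ¬ B i j ≈ 0#
    nonadjacent⇒B≉0 i≢j ¬i~j = Equivalence.from (proj₂ B∈S _ _ i≢j) (i≢j , ¬i~j)

    B≉0⇒nonadjacent : ∀ {i j} → i ≢ j → ¬ B i j ≈ 0# → ¬ Adj G i j
    B≉0⇒nonadjacent i≢j = proj₂ ∘ Equivalence.to (proj₂ B∈S _ _ i≢j)

    module _ (L : Leaf G) where
      open Leaf L renaming (leaf to ℓ; support to p; leaf~support to ℓ~p)

      ℓ≢p : ℓ ≢ p
      ℓ≢p refl = irrefl G ℓ~p

      LeafRowVanishes : Set ℓ₁
      LeafRowVanishes = ∀ j → A ℓ ℓ * B ℓ j + A ℓ p * B p j ≈ 0#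

      -- Equality in R is undecidable, so the entries of row ℓ off {ℓ, p} are only known
      -- to be ¬¬-zero; that suffices, since the row is only used to refute A p j ≈ 0.
      leaf-row : ¬ ¬ LeafRowVanishes
      leaf-row = ¬¬-map row (¬¬-pull A-zero-off-support)
        where
        A-zero-off-support : ∀ k → ¬ ¬ (k ≢ ℓ → k ≢ p → A ℓ k ≈ 0#)
        A-zero-off-support k ¬zero = ¬zero λ k≢ℓ k≢p →
          ⊥-elim (k≢p (support-unique (A≉0⇒adjacent (≢-sym k≢ℓ) λ Aℓk≈0 → ¬zero λ _ _ → Aℓk≈0)))
        row : (∀ k → k ≢ ℓ → k ≢ p → A ℓ k ≈ 0#) → LeafRowVanishes
        row A-zero j = begin
          A ℓ ℓ * B ℓ j + A ℓ p * B p j ≈⟨ sum-supported-at-pair (λ k → A ℓ k * B k j) ℓ≢p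
                                              (λ k k≢ℓ k≢p → ≈-trans (*-congʳ (A-zero k k≢ℓ k≢p)) (zeroˡ _)) ⟨
          sum (λ k → A ℓ k * B k j)     ≡⟨ ∑≡sum (λ k → A ℓ k * B k j) ⟨
          (_⊗_ R A B) ℓ j               ≈⟨ AB≈0 ℓ j ⟩
          0#                            ∎

      module _ (row : LeafRowVanishes) {j} (j≢ℓ : j ≢ ℓ) (j≢p : j ≢ p) (Apj≈0 : A p j ≈ 0#) where

        Aℓℓ≉0 : ¬ A ℓ ℓ ≈ 0#
        Aℓℓ≉0 = x*y≉0⇒x≉0 AℓℓBℓj≉0
          where
          Bpj≉0 : ¬ B p j ≈ 0#
          Bpj≉0 = nonadjacent⇒B≉0 (≢-sym j≢p) λ p~j → adjacent⇒A≉0 (≢-sym j≢p) p~j Apj≈0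
          AℓpBpj≉0 : ¬ A ℓ p * B p j ≈ 0#
          AℓpBpj≉0 = x≉0∧y≉0⇒x*y≉0 (adjacent⇒A≉0 ℓ≢p ℓ~p) Bpj≉0
          AℓℓBℓj≉0 : ¬ A ℓ ℓ * B ℓ j ≈ 0#
          AℓℓBℓj≉0 = x+y≈0∧x≉0⇒y≉0 (≈-trans (+-comm _ _) (row j)) AℓpBpj≉0

        support-has-no-other-neighbour : ∀ {x} → x ≢ ℓ → x ≢ p → ¬ Adj G p x
        support-has-no-other-neighbour {x} x≢ℓ x≢p = B≉0⇒nonadjacent (≢-sym x≢p) (x*y≉0⇒y≉0 AℓpBpx≉0)
          where
          Bℓx≉0 : ¬ B ℓ x ≈ 0#
          Bℓx≉0 = nonadjacent⇒B≉0 (≢-sym x≢ℓ) λ ℓ~x → x≢p (support-unique ℓ~x)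
          AℓpBpx≉0 : ¬ A ℓ p * B p x ≈ 0#
          AℓpBpx≉0 = x+y≈0∧x≉0⇒y≉0 (row x) (x≉0∧y≉0⇒x*y≉0 Aℓℓ≉0 Bℓx≉0)

        leaf-edge-closed : ∀ {u v} → Adj G u v → u ≡ ℓ ⊎ u ≡ p → v ≡ ℓ ⊎ v ≡ p
        leaf-edge-closed ℓ~v (inj₁ refl) = inj₂ (support-unique ℓ~v)
        leaf-edge-closed {v = v} p~v (inj₂ refl) with v ≟ ℓ | v ≟ p
        ... | yes v≡ℓ | _       = inj₁ v≡ℓ
        ... | no _    | yes v≡p = inj₂ v≡p
        ... | no v≢ℓ  | no v≢p  = ⊥-elim (support-has-no-other-neighbour v≢ℓ v≢p p~v)

      support-dominates : Connected G → Dominating G p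
      support-dominates connected j j≢p with j ≟ ℓ
      ... | yes refl = sym G ℓ~p
      ... | no j≢ℓ   = A≉0⇒adjacent (≢-sym j≢p) λ Apj≈0 → leaf-row λ row →
        [ j≢ℓ , j≢p ] (walk-preserves G _ (leaf-edge-closed row j≢ℓ j≢p Apj≈0) (connected ℓ j)
                                          (inj₁ refl))

  cv-tree⇒star : ∀ {n} (G : Graph n) → IsTree G → ComplementaryVanishing R G → IsStar G
  cv-tree⇒star {suc zero} G (_ , _ , acyclic) _ =
    dominating⇒star G acyclic {zero} λ { zero 0≢0 → ⊥-elim (0≢0 refl) }
  cv-tree⇒star {suc (suc n)} G (_ , connected , acyclic) (A , B , A∈S , B∈S , AB≈0) =
    dominating⇒star G acyclic
      (support-dominates A∈S B∈S AB≈0 (leaf-exists G connected acyclic {zero} {suc zero} λ ()) connected)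

  module StarMatrices {n} (c : Fin n) where

    χ : Fin n → Carrier
    χ k with k ≟ c
    ... | yes _ = 0#
    ... | no _  = 1#

    δ : Fin n → Fin n → Carrier
    δ k j with k ≟ j
    ... | yes _ = 1#
    ... | no _  = 0#

    leaves : Carrier
    leaves = sum χ

    A : Matrix R n
    A i j with i ≟ c | j ≟ c
    ... | yes _ | yes _ = 0#
    ... | yes _ | no _  = 1#
    ... | no _  | yes _ = 1#
    ... | no _  | no _  = 0#

    B : Matrix R n
    B i j with i ≟ c | j ≟ c
    ... | no _ | no _ = 1# + δ i j * - leaves
    ... | _    | _    = 0#

    δ-refl : ∀ j → δ j j ≡ 1#
    δ-refl j rewrite proj₂ (dec-yes (j ≟ j) refl) = refl

    δ-≢ : ∀ {k j} → k ≢ j → δ k j ≡ 0#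
    δ-≢ {k} {j} k≢j rewrite dec-no (k ≟ j) k≢j = refl

    A-centre-leaf : ∀ {k} → k ≢ c → A c k ≡ 1#
    A-centre-leaf {k} k≢c rewrite proj₂ (dec-yes (c ≟ c) refl) | dec-no (k ≟ c) k≢c = refl

    A-leaf-leaf : ∀ {i k} → i ≢ c → k ≢ c → A i k ≡ 0#
    A-leaf-leaf {i} {k} i≢c k≢c rewrite dec-no (i ≟ c) i≢c | dec-no (k ≟ c) k≢c = refl

    B-centre-row : ∀ j → B c j ≡ 0#
    B-centre-row j rewrite proj₂ (dec-yes (c ≟ c) refl) = refl

    B-centre-col : ∀ k → B k c ≡ 0#
    B-centre-col k rewrite proj₂ (dec-yes (c ≟ c) refl) with k ≟ c
    ... | yes _ = refl
    ... | no _ = refl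

    B-column : ∀ {j} → j ≢ c → ∀ k → B k j ≈ χ k + δ k j * - leaves
    B-column {j} j≢c k with k ≟ c
    ... | yes refl rewrite δ-≢ (≢-sym j≢c) = ≈-sym (≈-trans (+-identityˡ _) (zeroˡ _))
    ... | no k≢c rewrite dec-no (j ≟ c) j≢c = ≈-refl

    δ-sym : ∀ i j → δ i j ≡ δ j i
    δ-sym i j with i ≟ j | j ≟ i
    ... | yes _   | yes _   = refl
    ... | no _    | no _    = refl
    ... | yes i≡j | no j≢i  = ⊥-elim (j≢i (≡.sym i≡j))
    ... | no i≢j  | yes j≡i = ⊥-elim (i≢j (≡.sym j≡i))

    A-symmetric : ∀ i j → A i j ≈ A j i
    A-symmetric i j with i ≟ c | j ≟ c
    ... | yes _ | yes _ = ≈-refl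
    ... | yes _ | no _  = ≈-refl
    ... | no _  | yes _ = ≈-refl
    ... | no _  | no _  = ≈-refl

    B-symmetric : ∀ i j → B i j ≈ B j i
    B-symmetric i j with i ≟ c | j ≟ c
    ... | yes _ | yes _ = ≈-refl
    ... | yes _ | no _  = ≈-refl
    ... | no _  | yes _ = ≈-refl
    ... | no _  | no _  = ≈-reflexive (cong (λ d → 1# + d * - leaves) (δ-sym i j))

    module _ {G : Graph n} (star : ∀ i j → Adj G i j ⇔ ((i ≢ j) × (i ≡ c ⊎ j ≡ c))) where

      centre-adjacent : ∀ {i j} → i ≢ j → i ≡ c ⊎ j ≡ c → Adj G i j
      centre-adjacent i≢j incident = Equivalence.from (star _ _) (i≢j , incident)

      leaves-nonadjacent : ∀ {i j} → i ≢ c → j ≢ c → ¬ Adj G i j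
      leaves-nonadjacent i≢c j≢c i~j = [ i≢c , j≢c ] (proj₂ (Equivalence.to (star _ _) i~j))

      A∈S : InS R G A
      A∈S = A-symmetric , nonzero-pattern
        where
        nonzero-pattern : ∀ i j → i ≢ j → (¬ A i j ≈ 0#) ⇔ Adj G i j
        nonzero-pattern i j i≢j with i ≟ c | j ≟ c
        ... | yes refl | yes refl = ⊥-elim (i≢j refl)
        ... | yes i≡c  | no _     = mk⇔ (λ _ → centre-adjacent i≢j (inj₁ i≡c)) (λ _ → 1≉0)
        ... | no _     | yes j≡c  = mk⇔ (λ _ → centre-adjacent i≢j (inj₂ j≡c)) (λ _ → 1≉0)
        ... | no i≢c   | no j≢c   = mk⇔ (λ 0≉0 → ⊥-elim (0≉0 ≈-refl)) (⊥-elim ∘ leaves-nonadjacent i≢c j≢c)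

      B∈S : InS R (complement G) B
      B∈S = B-symmetric , nonzero-pattern
        where
        nonzero-pattern : ∀ i j → i ≢ j → (¬ B i j ≈ 0#) ⇔ Adj (complement G) i j
        nonzero-pattern i j i≢j with i ≟ c | j ≟ c
        ... | yes i≡c | _       = mk⇔ (λ 0≉0 → ⊥-elim (0≉0 ≈-refl))
                                      (λ (_ , ¬i~j) → ⊥-elim (¬i~j (centre-adjacent i≢j (inj₁ i≡c))))
        ... | no _    | yes j≡c = mk⇔ (λ 0≉0 → ⊥-elim (0≉0 ≈-refl))
                                      (λ (_ , ¬i~j) → ⊥-elim (¬i~j (centre-adjacent i≢j (inj₂ j≡c))))
        ... | no i≢c  | no j≢c rewrite δ-≢ i≢j =
          mk⇔ (λ _ → i≢j , leaves-nonadjacent i≢c j≢c)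
              (λ _ 1+0≈0 → 1≉0 (≈-trans (≈-sym (≈-trans (+-congˡ (zeroˡ _)) (+-identityʳ 1#))) 1+0≈0))

    centre-row-term : ∀ k j → A c k * B k j ≈ B k j
    centre-row-term k j = by-cases (k ≟ c)
      where
      by-cases : Dec (k ≡ c) → A c k * B k j ≈ B k j
      by-cases (yes refl) = ≈-trans (*-congˡ B≈0) (≈-trans (zeroʳ _) (≈-sym B≈0))
        where B≈0 = ≈-reflexive (B-centre-row j)
      by-cases (no k≢c)   = ≈-trans (*-congʳ (≈-reflexive (A-centre-leaf k≢c))) (*-identityˡ _)

    leaf-column-sum : ∀ {j} → j ≢ c → sum (λ k → B k j) ≈ 0#
    leaf-column-sum {j} j≢c = begin
      sum (λ k → B k j)                        ≈⟨ sum-cong-≋ (B-column j≢c) ⟩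
      sum (λ k → χ k + δ k j * - leaves)       ≈⟨ ∑-distrib-+ χ (λ k → δ k j * - leaves) ⟩
      leaves + sum (λ k → δ k j * - leaves)    ≈⟨ +-congˡ (sum-supported-at _ j off-diagonal) ⟩
      leaves + δ j j * - leaves                ≡⟨ cong (λ d → leaves + d * - leaves) (δ-refl j) ⟩
      leaves + 1# * - leaves                   ≈⟨ +-congˡ (*-identityˡ _) ⟩
      leaves - leaves                          ≈⟨ -‿inverseʳ leaves ⟩
      0#                                       ∎
      where
      off-diagonal : ∀ k → k ≢ j → δ k j * - leaves ≈ 0#
      off-diagonal k k≢j rewrite δ-≢ k≢j = zeroˡ _

    leaf-row-term : ∀ {i} → i ≢ c → ∀ k j → A i k * B k j ≈ 0#
    leaf-row-term {i} i≢c k j = by-cases (k ≟ c)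
      where
      by-cases : Dec (k ≡ c) → A i k * B k j ≈ 0#
      by-cases (yes refl) = ≈-trans (*-congˡ (≈-reflexive (B-centre-row j))) (zeroʳ _)
      by-cases (no k≢c)   = ≈-trans (*-congʳ (≈-reflexive (A-leaf-leaf i≢c k≢c))) (zeroˡ _)

    AB≈0 : ∀ i j → sum (λ k → A i k * B k j) ≈ 0#
    AB≈0 i j = by-cases (i ≟ c) (j ≟ c)
      where
      by-cases : Dec (i ≡ c) → Dec (j ≡ c) → sum (λ k → A i k * B k j) ≈ 0#
      by-cases (no i≢c)   _          = sum-zero λ k → leaf-row-term i≢c k j
      by-cases (yes refl) (yes refl) = sum-zero λ k → ≈-trans (*-congˡ (≈-reflexive (B-centre-col k))) (zeroʳ _)
      by-cases (yes refl) (no j≢c)   = ≈-trans (sum-cong-≋ λ k → centre-row-term k j) (leaf-column-sum j≢c)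

  star⇒cv : ∀ {n} (G : Graph n) → IsStar G → ComplementaryVanishing R G
  star⇒cv G (c , star) =
    A , B , A∈S {G} star , B∈S {G} star , λ i j → ≈-trans (≈-reflexive (∑≡sum (λ k → A i k * B k j))) (AB≈0 i j)
    where open StarMatrices c

corollary1p7 : ∀ {c ℓ₁ ℓ₂ : Level} (R : RealField c ℓ₁ ℓ₂) {n : ℕ} (G : Graph n) →
                   IsTree G → (ComplementaryVanishing R G ⇔ IsStar G)
corollary1p7 R G tree = mk⇔ (cv-tree⇒star R G tree) (star⇒cv R G)
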